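{- Let $p$ be a prime with $p\equiv 1\pmod 4$ and $m\ge 1$ an integer. Then $\Gamma(\mathbb{Z}_{p^m})$ is pancyclic if and only if $m=2$.
   Context: For a finite commutative ring $R$ with unity, the zero-divisor graph $\Gamma(R)$ has vertex set the nonzero zero-divisors of $R$, with distinct $x,y$ adjacent iff $xy=0$. A graph of order $N$ is pancyclic if $N\ge 3$ and it contains a cycle of length $k$ for every $3\le k\le N$. -}

module Defs where

open import Data.Nat using (ℕ; zero; suc; _<_; _≤_)
open import Data.Nat.DivMod using (_mod_)
open import Data.Nat.Divisibility using (_∣_)
open import Data.Fin using (Fin; toℕ)
open import Data.Product using (Σ; ∃; _×_)
open import Function.Definitions using (Injective)
open import Relation.Binary.PropositionalEquality using (_≡_; _≢_)
open import Data.Nat using (_*_)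

record Graph : Set₁ where
  field
    IsVertex : ℕ → Set
    Adj      : ℕ → ℕ → Set

open Graph public

HasOrder : Graph → ℕ → Set
HasOrder G N =
  Σ (Fin N → ℕ) λ e →
    Injective _≡_ _≡_ e × (∀ i → IsVertex G (e i))
      × (∀ x → IsVertex G x → ∃ λ i → e i ≡ x)

next : ∀ {k} → Fin k → Fin k
next {suc k} i = suc (toℕ i) mod (suc k)

HasCycle : Graph → ℕ → Set
HasCycle G k =
  Σ (Fin k → ℕ) λ c →
    Injective _≡_ _≡_ c × (∀ i → IsVertex G (c i))
      × (∀ i → Adj G (c i) (c (next i)))

Pancyclic : Graph → Set
Pancyclic G =
  Σ ℕ λ N → HasOrder G N × 3 ≤ N × (∀ k → 3 ≤ k → k ≤ N → HasCycle G k)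

-- Zero-divisor graph of ℤ_n, elements represented by 0,…,n-1;
-- x·y = 0 in ℤ_n  iff  n ∣ x * y.
Γℤ : ℕ → Graph
Γℤ n = record
  { IsVertex = λ x → x < n × x ≢ 0 × (∃ λ y → y < n × y ≢ 0 × n ∣ x * y)
  ; Adj      = λ x y → x ≢ y × n ∣ x * y
  }

module Submission where

-- m = 1: ℤ_p is a field, so Γ(ℤ_p) has no vertices at all, while a
--   pancyclic graph has at least three.
-- m = 2: the vertices of Γ(ℤ_{p²}) are the p - 1 nonzero multiples of p and any
--   two of them multiply to 0, so the graph is complete of order p - 1 ≥ 3;
--   complete graphs of order ≥ 3 are pancyclic.
-- m ≥ 3: the p vertices p·(1 + kp), k < p, have p-adic valuation exactly one,
--   so each of their neighbours is a nonzero multiple of p^{m-1}, and there are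
--   only p - 1 of those.  A Hamiltonian cycle visits every vertex and sends
--   each of the p vertices to a distinct successor, which is impossible by
--   pigeonhole.

open import Defs
open import Data.Nat using (ℕ; _^_; _%_; _≤_)
open import Data.Nat.Primality using (Prime)
open import Function.Bundles using (_⇔_)
open import Relation.Binary.PropositionalEquality using (_≡_)

open import Data.Nat using (zero; suc; _+_; _*_; _<_; z≤n; s≤s; s≤s⁻¹; NonZero; ≢-nonZero; ≢-nonZero⁻¹; nonTrivial⇒n>1)
open import Data.Nat.Properties
  using (suc-injective; 1+n≢n; m≤n⇒m<n∨m≡n; <⇒≱; <⇒≤; ≤-refl; *-assoc; *-comm; *-identityʳ; ^-identityʳ;
         *-cancelʳ-≡; *-cancelˡ-≡; *-cancelʳ-<; *-monoˡ-<; *-monoʳ-<; *-monoˡ-≤; *-monoʳ-≤;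
         +-monoˡ-<; +-comm; m≤m*n; m<m*n; m^n≢0; module ≤-Reasoning)
open import Data.Nat.Divisibility
  using (_∣_; divides; _∣?_; ∣-refl; 1∣_; ∣⇒≤; ∣m+n∣m⇒∣n; n∣m*n; m∣m*n; m*n∣⇒m∣; *-pres-∣; *-monoʳ-∣; *-cancelˡ-∣)
open import Data.Nat.DivMod using (m<n⇒m%n≡m; n%n≡0)
open import Data.Nat.Primality using (euclidsLemma; prime⇒nonZero; prime⇒nonTrivial; ¬prime[1])
open import Data.Fin using (Fin; toℕ; fromℕ<; inject≤; punchOut)
open import Data.Fin.Properties
  using (toℕ-fromℕ<; toℕ-injective; toℕ<n; inject≤-injective; <⇒notInjective; punchOut-injective; any?)
import Data.Fin as Fin
open import Data.Product using (∃; _×_; _,_; proj₁; proj₂)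
open import Data.Sum using (_⊎_; inj₁; inj₂)
open import Data.Empty using (⊥-elim)
open import Relation.Nullary using (¬_; yes; no; contradiction)
open import Relation.Binary.PropositionalEquality using (_≢_; refl; sym; trans; cong; subst; module ≡-Reasoning)
open import Function.Definitions using (Injective)
open import Function.Bundles using (mk⇔)

NextCases : ∀ {k} → Fin (suc k) → Set
NextCases {k} i = toℕ (next i) ≡ suc (toℕ i) ⊎ (toℕ i ≡ k × toℕ (next i) ≡ 0)

next-cases : ∀ {k} (i : Fin (suc k)) → NextCases i
next-cases {k} i with m≤n⇒m<n∨m≡n (s≤s⁻¹ (toℕ<n i))
... | inj₁ i<k  = inj₁ (trans (toℕ-fromℕ< _) (m<n⇒m%n≡m (s≤s i<k)))
... | inj₂ i≡k  = inj₂ (i≡k , trans (toℕ-fromℕ< _) (subst (λ t → suc t % suc k ≡ 0) (sym i≡k) (n%n≡0 (suc k))))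

next-injective : ∀ {k} → Injective _≡_ _≡_ (next {k})
next-injective {suc k} {i} {j} eq = toℕ-injective (compare (next-cases i) (next-cases j))
  where
  eqℕ : toℕ (next i) ≡ toℕ (next j)
  eqℕ = cong toℕ eq
  compare : NextCases i → NextCases j → toℕ i ≡ toℕ j
  compare (inj₁ ni)       (inj₁ nj)       = suc-injective (trans (sym ni) (trans eqℕ nj))
  compare (inj₂ (i≡k , _)) (inj₂ (j≡k , _)) = trans i≡k (sym j≡k)
  compare (inj₁ ni)       (inj₂ (_ , nj)) = contradiction (trans (sym ni) (trans eqℕ nj)) λ ()
  compare (inj₂ (_ , ni)) (inj₁ nj)       = contradiction (trans (sym nj) (trans (sym eqℕ) ni)) λ ()

next-moves : ∀ {k} (i : Fin (suc (suc k))) → next i ≢ i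
next-moves i eq with next-cases i
... | inj₁ ni         = 1+n≢n (trans (sym ni) (cong toℕ eq))
... | inj₂ (i≡k , n0) = contradiction (trans (sym i≡k) (trans (sym (cong toℕ eq)) n0)) λ ()

injective⇒surjective : ∀ {n} {f : Fin n → Fin n} → Injective _≡_ _≡_ f → ∀ j → ∃ λ i → f i ≡ j
injective⇒surjective {suc n} {f} f-inj j with any? (λ i → f i Fin.≟ j)
... | yes hit = hit
... | no miss = ⊥-elim (<⇒notInjective ≤-refl g-inj)
  where
  -- f misses j, so it factors injectively through Fin n.
  g : Fin (suc n) → Fin n
  g i = punchOut {i = j} λ eq → miss (i , sym eq)
  g-inj : Injective _≡_ _≡_ g
  g-inj {x} {y} eq = f-inj (punchOut-injective (λ e → miss (x , sym e)) (λ e → miss (y , sym e)) eq)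

hamiltonian-covers : ∀ {G N} → HasOrder G N → (cyc : HasCycle G N) →
  ∀ x → IsVertex G x → ∃ λ i → proj₁ cyc i ≡ x
hamiltonian-covers {G} {N} (e , _ , _ , e-onto) (c , c-inj , c-vert , _) x x-vert =
  i , (begin c i ≡⟨ sym (index-spec i) ⟩ e (index i) ≡⟨ cong e hit ⟩ e a ≡⟨ a-spec ⟩ x ∎)
  where
  open ≡-Reasoning
  index : Fin N → Fin N
  index i = proj₁ (e-onto (c i) (c-vert i))
  index-spec : ∀ i → e (index i) ≡ c i
  index-spec i = proj₂ (e-onto (c i) (c-vert i))
  index-inj : Injective _≡_ _≡_ index
  index-inj {i} {j} eq = c-inj (trans (sym (index-spec i)) (trans (cong e eq) (index-spec j)))
  a : Fin N
  a = proj₁ (e-onto x x-vert)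
  a-spec : e a ≡ x
  a-spec = proj₂ (e-onto x x-vert)
  i : Fin N
  i = proj₁ (injective⇒surjective index-inj a)
  hit : index i ≡ a
  hit = proj₂ (injective⇒surjective index-inj a)

-- A graph of order N ≥ 3 in which distinct vertices are always adjacent is
-- pancyclic: any k ≤ N of its vertices, taken in order, form a k-cycle.
complete⇒pancyclic : ∀ {G N} → HasOrder G N → 3 ≤ N →
  (∀ x y → IsVertex G x → IsVertex G y → x ≢ y → Adj G x y) → Pancyclic G
complete⇒pancyclic {G} {N} ord@(e , e-inj , e-vert , _) 3≤N complete = N , ord , 3≤N , cycle
  where
  cycle : ∀ k → 3 ≤ k → k ≤ N → HasCycle G k
  cycle k@(suc (suc (suc _))) (s≤s (s≤s (s≤s _))) k≤N = c , c-inj , c-vert , c-adj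
    where
    c : Fin k → ℕ
    c i = e (inject≤ i k≤N)
    c-inj : Injective _≡_ _≡_ c
    c-inj {i} {j} eq = inject≤-injective k≤N k≤N i j (e-inj eq)
    c-vert : ∀ i → IsVertex G (c i)
    c-vert i = e-vert (inject≤ i k≤N)
    c-adj : ∀ i → Adj G (c i) (c (next i))
    c-adj i = complete _ _ (c-vert i) (c-vert (next i)) λ eq → next-moves i (sym (c-inj eq))

-- Pigeonhole obstruction: if n + 1 distinct vertices all have their neighbours
-- among n given vertices, then no cycle passes through every vertex, because
-- the successors of those n + 1 vertices on such a cycle would be distinct.
crowded⇒¬hamiltonian : ∀ {G N n} → HasOrder G N →
  (a : Fin (suc n) → ℕ) → Injective _≡_ _≡_ a → (∀ i → IsVertex G (a i)) →
  (b : Fin n → ℕ) → (∀ i y → IsVertex G y → Adj G (a i) y → ∃ λ j → b j ≡ y) →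
  ¬ HasCycle G N
crowded⇒¬hamiltonian {G} {N} {n} ord a a-inj a-vert b neighbours cyc@(c , c-inj , c-vert , c-adj) =
  <⇒notInjective ≤-refl successor-inj
  where
  pos : Fin (suc n) → Fin N
  pos i = proj₁ (hamiltonian-covers {G} ord cyc (a i) (a-vert i))
  pos-spec : ∀ i → c (pos i) ≡ a i
  pos-spec i = proj₂ (hamiltonian-covers {G} ord cyc (a i) (a-vert i))
  successor : ∀ i → ∃ λ j → b j ≡ c (next (pos i))
  successor i = neighbours i _ (c-vert (next (pos i)))
                  (subst (λ x → Adj G x (c (next (pos i)))) (pos-spec i) (c-adj (pos i)))
  successor-inj : Injective _≡_ _≡_ (λ i → proj₁ (successor i))
  successor-inj {i} {j} eq = a-inj (trans (sym (pos-spec i)) (trans (cong c same-pos) (pos-spec j)))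
    where
    same-pos : pos i ≡ pos j
    same-pos = next-injective (c-inj (trans (sym (proj₂ (successor i)))
                                     (trans (cong b eq) (proj₂ (successor j)))))

prime-power-cancel : ∀ {p} → Prime p → ∀ n {a y} → ¬ p ∣ a → p ^ n ∣ a * y → p ^ n ∣ y
prime-power-cancel pr zero    {y = y} _ _ = 1∣ y
prime-power-cancel {p} pr (suc n) {a} {y} p∤a p^[1+n]∣ay
  with euclidsLemma a y pr (m*n∣⇒m∣ p (p ^ n) p^[1+n]∣ay)
... | inj₁ p∣a = contradiction p∣a p∤a
... | inj₂ (divides q refl) =
  subst (p * p ^ n ∣_) (*-comm p q) (*-monoʳ-∣ p (prime-power-cancel pr n p∤a p^n∣aq))
  where
  instance
    p≢0 : NonZero p
    p≢0 = prime⇒nonZero pr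
  open ≡-Reasoning
  regroup : a * (q * p) ≡ p * (a * q)
  regroup = begin
    a * (q * p) ≡⟨ cong (a *_) (*-comm q p) ⟩
    a * (p * q) ≡⟨ sym (*-assoc a p q) ⟩
    a * p * q   ≡⟨ cong (_* q) (*-comm a p) ⟩
    p * a * q   ≡⟨ *-assoc p a q ⟩
    p * (a * q) ∎
  p^n∣aq : p ^ n ∣ a * q
  p^n∣aq = *-cancelˡ-∣ p (subst (p * p ^ n ∣_) regroup p^[1+n]∣ay)

multiple : ∀ {c} → ℕ → Fin c → ℕ
multiple d j = suc (toℕ j) * d

multiple-injective : ∀ {c} d .{{_ : NonZero d}} → Injective _≡_ _≡_ (multiple {c} d)
multiple-injective d {i} {j} eq = toℕ-injective (suc-injective (*-cancelʳ-≡ (suc (toℕ i)) (suc (toℕ j)) d eq))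

multiple-bound : ∀ {c} d .{{_ : NonZero d}} (j : Fin c) → multiple d j < suc c * d
multiple-bound d j = *-monoˡ-< d (s≤s (toℕ<n j))

multiple-complete : ∀ c d {y} → d ∣ y → y ≢ 0 → y < suc c * d → ∃ λ (j : Fin c) → multiple d j ≡ y
multiple-complete c d (divides zero refl)    y≢0 _   = contradiction refl y≢0
multiple-complete c d (divides (suc q) refl) _   y<  =
  fromℕ< q<c , cong (λ t → suc t * d) (toℕ-fromℕ< q<c)
  where
  q<c : q < c
  q<c = s≤s⁻¹ (*-cancelʳ-< d (suc q) (suc c) y<)

Γℤ-prime-no-vertex : ∀ {p x} → Prime p → ¬ IsVertex (Γℤ p) x
Γℤ-prime-no-vertex {x = x} pr (x<p , x≢0 , y , y<p , y≢0 , p∣xy) with euclidsLemma x y pr p∣xy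
... | inj₁ p∣x = <⇒≱ x<p (∣⇒≤ {{≢-nonZero x≢0}} p∣x)
... | inj₂ p∣y = <⇒≱ y<p (∣⇒≤ {{≢-nonZero y≢0}} p∣y)

pancyclic⇒vertex : ∀ {G} → Pancyclic G → ∃ (IsVertex G)
pancyclic⇒vertex (suc _ , (e , _ , e-vert , _) , s≤s _ , _) = e Fin.zero , e-vert Fin.zero

prime-not-pancyclic : ∀ {p} → Prime p → ¬ Pancyclic (Γℤ (p ^ 1))
prime-not-pancyclic {p} pr pan with pancyclic⇒vertex {Γℤ (p ^ 1)} pan
... | x , x-vert = Γℤ-prime-no-vertex pr (subst (λ n → IsVertex (Γℤ n) x) (^-identityʳ p) x-vert)

module PrimePower (p' : ℕ) (p-prime : Prime (suc p')) where

  p : ℕ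
  p = suc p'

  1<p : 1 < p
  1<p = nonTrivial⇒n>1 p {{prime⇒nonTrivial p-prime}}

  p²≡p*p : p ^ 2 ≡ p * p
  p²≡p*p = cong (p *_) (*-identityʳ p)

  -- Every vertex of Γ(ℤ_{p²}) is a multiple of p: a nonzero y < p² with
  -- p² ∣ x·y cannot exist when p ∤ x.
  square-vertex-multiple : ∀ {x} → IsVertex (Γℤ (p ^ 2)) x → p ∣ x
  square-vertex-multiple {x} (_ , _ , y , y< , y≢0 , p²∣xy) with p ∣? x
  ... | yes p∣x = p∣x
  ... | no p∤x  = contradiction (∣⇒≤ {{≢-nonZero y≢0}} (prime-power-cancel p-prime 2 p∤x p²∣xy)) (<⇒≱ y<)

  square-divides : ∀ {x y} → p ∣ x → p ∣ y → p ^ 2 ∣ x * y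
  square-divides {x} {y} p∣x p∣y = subst (_∣ x * y) (sym p²≡p*p) (*-pres-∣ p∣x p∣y)

  square-order : HasOrder (Γℤ (p ^ 2)) p'
  square-order = multiple p , multiple-injective p , vertex , covered
    where
    below : ∀ j → multiple p j < p ^ 2
    below j = subst (multiple p j <_) (sym p²≡p*p) (multiple-bound p j)
    vertex : ∀ j → IsVertex (Γℤ (p ^ 2)) (multiple p j)
    vertex j = below j , (λ ()) , multiple p j , below j , (λ ()) ,
               square-divides (n∣m*n (suc (toℕ j))) (n∣m*n (suc (toℕ j)))
    covered : ∀ x → IsVertex (Γℤ (p ^ 2)) x → ∃ λ j → multiple p j ≡ x
    covered x v@(x< , x≢0 , _) =
      multiple-complete p' p (square-vertex-multiple v) x≢0 (subst (x <_) p²≡p*p x<)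

  square-pancyclic : 3 ≤ p' → Pancyclic (Γℤ (p ^ 2))
  square-pancyclic 3≤p' = complete⇒pancyclic {Γℤ (p ^ 2)} square-order 3≤p' λ x y vx vy x≢y →
    x≢y , square-divides (square-vertex-multiple vx) (square-vertex-multiple vy)

  -- For m = r + 3 write p^m = p · P with P = p^{m-1}.
  module HigherPower (r : ℕ) where

    P : ℕ
    P = p ^ suc (suc r)

    instance
      P≢0 : NonZero P
      P≢0 = m^n≢0 p (suc (suc r))
      p^r≢0 : NonZero (p ^ r)
      p^r≢0 = m^n≢0 p r

    G : Graph
    G = Γℤ (p * P)

    -- 1 + kp is prime to p; the p numbers p(1 + kp), k < p, are vertices of
    -- p-adic valuation exactly one.
    unit : Fin p → ℕ
    unit k = suc (toℕ k * p)

    valuation-one : Fin p → ℕ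
    valuation-one k = p * unit k

    unit-coprime : ∀ k → ¬ p ∣ unit k
    unit-coprime k p∣unit = <⇒≱ 1<p (∣⇒≤ p∣1)
      where
      p∣1 : p ∣ 1
      p∣1 = ∣m+n∣m⇒∣n (subst (p ∣_) (+-comm 1 (toℕ k * p)) p∣unit) (n∣m*n (toℕ k))

    unit-bound : ∀ k → unit k < P
    unit-bound k = begin-strict
      1 + toℕ k * p    <⟨ +-monoˡ-< (toℕ k * p) 1<p ⟩
      suc (toℕ k) * p  ≤⟨ *-monoˡ-≤ p (toℕ<n k) ⟩
      p * p            ≤⟨ *-monoʳ-≤ p (m≤m*n p (p ^ r)) ⟩
      P                ∎
      where open ≤-Reasoning

    valuation-one-injective : Injective _≡_ _≡_ valuation-one
    valuation-one-injective {k} {l} eq =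
      toℕ-injective (*-cancelʳ-≡ (toℕ k) (toℕ l) p (suc-injective (*-cancelˡ-≡ (unit k) (unit l) p eq)))

    valuation-one-vertex : ∀ k → IsVertex G (valuation-one k)
    valuation-one-vertex k =
      *-monoʳ-< p (unit-bound k) , (λ ()) ,
      P , subst (P <_) (*-comm P p) (m<m*n P p 1<p) , ≢-nonZero⁻¹ P , *-pres-∣ (m∣m*n {p} (unit k)) (∣-refl {P})

    valuation-one-neighbours : ∀ k y → IsVertex G y → Adj G (valuation-one k) y →
      ∃ λ (j : Fin p') → multiple P j ≡ y
    valuation-one-neighbours k y (y< , y≢0 , _) (_ , pP∣xy) =
      multiple-complete p' P (prime-power-cancel p-prime (suc (suc r)) (unit-coprime k) P∣unit·y) y≢0 y<
      where
      P∣unit·y : P ∣ unit k * y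
      P∣unit·y = *-cancelˡ-∣ p (subst (p * P ∣_) (*-assoc p (unit k) y) pP∣xy)

    higher-not-pancyclic : ¬ Pancyclic G
    higher-not-pancyclic (N , ord , 3≤N , cycles) =
      crowded⇒¬hamiltonian {G} ord valuation-one valuation-one-injective valuation-one-vertex
        (multiple P) valuation-one-neighbours (cycles N 3≤N ≤-refl)

prime-power-pancyclic : ∀ {p} → Prime p → 4 ≤ p → ∀ m → 1 ≤ m → Pancyclic (Γℤ (p ^ m)) ⇔ m ≡ 2
prime-power-pancyclic {suc p'} pr (s≤s 3≤p') m 1≤m = mk⇔ (only-square m 1≤m) λ { refl → square-pancyclic 3≤p' }
  where
  open PrimePower p' pr
  only-square : ∀ m → 1 ≤ m → Pancyclic (Γℤ (suc p' ^ m)) → m ≡ 2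
  only-square 0                   ()
  only-square 1                   _ pan = ⊥-elim (prime-not-pancyclic pr pan)
  only-square 2                   _ _   = refl
  only-square (suc (suc (suc r))) _ pan = ⊥-elim (HigherPower.higher-not-pancyclic r pan)

prime-1-mod-4⇒5≤p : ∀ {p} → Prime p → p % 4 ≡ 1 → 5 ≤ p
prime-1-mod-4⇒5≤p {0} _  ()
prime-1-mod-4⇒5≤p {1} pr _ = contradiction pr ¬prime[1]
prime-1-mod-4⇒5≤p {2} _  ()
prime-1-mod-4⇒5≤p {3} _  ()
prime-1-mod-4⇒5≤p {4} _  ()
prime-1-mod-4⇒5≤p {suc (suc (suc (suc (suc _))))} _ _ = s≤s (s≤s (s≤s (s≤s (s≤s z≤n))))

theorem2p7 : (p m : ℕ) → Prime p → p % 4 ≡ 1 → 1 ≤ m →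
    (Pancyclic (Γℤ (p ^ m)) ⇔ m ≡ 2)
theorem2p7 p m pr p≡1[4] 1≤m = prime-power-pancyclic pr (<⇒≤ (prime-1-mod-4⇒5≤p pr p≡1[4])) m 1≤m
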